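{- Let $m,n$ be positive integers and let $\mathcal{P}(m,n)\subseteq\mathbb{R}^m$ be the convex hull of all words of length $m$ with entries in $\{0,1,\ldots,n\}$ whose nonzero entries are pairwise distinct. Then the number of facets of $\mathcal{P}(m,n)$ equals \[ m+2^m-1-\sum_{r=1}^{m-n}\binom{m}{m-r}, \] where the sum is empty if $m\le n$.
   Context: Words of length $m$ are regarded as vectors in $\mathbb{R}^m$.
   Formalization: The supporting hyperplanes c·x ≤ b that define the faces and facets of $\mathcal{P}(m,n)$ have rational coefficients and right-hand sides instead of real ones. -}

module Defs where

open import Data.Nat using (ℕ; zero; suc; _+_; _∸_)
open import Data.Nat.Combinatorics using (_C_)
open import Data.Fin using (Fin; toℕ)
import Data.Fin as Fin
open import Data.Integer using (+_)
open import Data.Rational using (ℚ; _≤_; _<_; 0ℚ) renaming (_+_ to _+ℚ_; _*_ to _*ℚ_)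
import Data.Rational as ℚ
open import Data.Product using (_×_; Σ; ∃; _,_)
open import Relation.Binary.PropositionalEquality using (_≡_; _≢_)
open import Function.Bundles using (_⇔_)

Word : ℕ → ℕ → Set
Word m n = Fin m → Fin (suc n)

Valid : ∀ {m n} → Word m n → Set
Valid {m} w = (i j : Fin m) → i ≢ j → toℕ (w i) ≢ 0 → w i ≢ w j

-- the word as a point of ℚ^m ⊆ ℝ^m
coord : ∀ {m n} → Word m n → Fin m → ℚ
coord w i = (+ toℕ (w i)) ℚ./ 1

sumFin : (m : ℕ) → (Fin m → ℚ) → ℚ
sumFin zero f = 0ℚ
sumFin (suc m) f = f Fin.zero +ℚ sumFin m (λ i → f (Fin.suc i))

dot : ∀ {m n} → (Fin m → ℚ) → Word m n → ℚ
dot {m} c w = sumFin m (λ i → c i *ℚ coord w i)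

-- a (linear functional, right-hand side) pair describing c·x ≤ b
Ineq : ℕ → Set
Ineq m = (Fin m → ℚ) × ℚ

module _ {m n : ℕ} where
  -- c·x ≤ b is valid on P(m,n) (equivalently on all generating words)
  Supporting : Ineq m → Set
  Supporting (c , b) = (w : Word m n) → Valid w → dot c w ≤ b

  -- generating words lying on the face {x ∈ P | c·x = b}
  -- (a face of a polytope is the convex hull of the generators it contains)
  OnFace : Ineq m → Word m n → Set
  OnFace (c , b) w = Valid w × dot c w ≡ b

  SubFace : Ineq m → Ineq m → Set
  SubFace f g = (w : Word m n) → OnFace f w → OnFace g w

  SameFace : Ineq m → Ineq m → Set
  SameFace f g = (w : Word m n) → OnFace f w ⇔ OnFace g w

  Proper : Ineq m → Set
  Proper (c , b) = ∃ λ (w : Word m n) → Valid w × dot c w < b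

  NonEmpty : Ineq m → Set
  NonEmpty f = ∃ λ (w : Word m n) → OnFace f w

  IsFace : Ineq m → Set
  IsFace f = Supporting f × NonEmpty f

  IsFacet : Ineq m → Set
  IsFacet f = IsFace f × Proper f ×
              ((g : Ineq m) → IsFace g → Proper g → SubFace f g → SubFace g f)

binomSum : ℕ → ℕ → ℕ
binomSum m zero = 0
binomSum m (suc k) = binomSum m k + m C (m ∸ suc k)

{-# OPTIONS --safe #-}
-- The generating words are the vectors x ∈ {0, …, n}^m whose nonzero entries are distinct; call
-- them admissible.  For such x and S ⊆ [m], the nonzero values x_i (i ∈ S) are distinct numbers ≤ n,
-- so x(S) = Σ_{i ∈ S} x_i is at most n + (n - 1) + ⋯, the sum of the |S| largest of them.  The facets
-- are the m inequalities -x_i ≤ 0 and the inequalities x(S) ≤ n + (n - 1) + ⋯ with 1 ≤ |S| < n or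
-- S = [m].  Conversely, let c · x ≤ b define a proper face.  If some c_i < 0, the face lies in
-- {x_i = 0}, since lowering x_i to 0 would increase c · x.  Otherwise let T be the set where c
-- attains its (positive) maximum: on the face no value on T can be raised to an unused value, nor
-- exchanged with a larger value outside T, so the values on T are the |T| largest possible ones and
-- the face lies in the face of T (if |T| < n) or of [m].  Explicit admissible points separate any two
-- of the listed faces, so these are exactly the facets, and counting subsets by size shows that the
-- missing nonempty subsets, those with n ≤ |S| < m, number Σ_{r=1}^{m-n} C(m, m-r).
module Submission where

open import Algebra.Bundles using (CommutativeMonoid)
import Algebra.Properties.CommutativeMonoid.Sum as Sum
open import Data.Bool using (true; false; if_then_else_)
import Data.Bool.Properties as Bool
open import Data.Fin using (Fin; zero; suc; toℕ; fromℕ<)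
open import Data.Fin.Permutation.Components using (transpose; transpose-inverse)
import Data.Fin.Properties as FinP
open FinP using (any?; toℕ-injective; toℕ-fromℕ<; toℕ<n) renaming (_≟_ to _≟ᶠ_)
open import Data.Fin.Subset using (Subset; inside; outside; _∈_; _∉_; _⊆_; _-_; ⁅_⁆; ∣_∣; ⊤; ⊥)
open import Data.Fin.Subset.Properties
  using (_∈?_; nonempty?; Empty-unique; ∣⊥∣≡0; p─⊥≡p; p─q⊆p; drop-∷-⊆; drop-there; x∈p∧x≢y⇒x∈p-y;
         x≢y⇒x∉⁅y⁆; ∈⊤; ⊆⊤; ∣p∣≤n; ∣⊤∣≡n; ∣p∣≡n⇒p≡⊤; ⊆-antisym; p⊆q⇒∣p∣≤∣q∣; p⊂q⇒∣p∣<∣q∣;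
         x∈p⇒∣p-x∣<∣p∣)
import Data.Integer as ℤ
import Data.Integer.Properties as ℤₚ
open import Data.List as List using (List; []; _∷_; _++_; filter; length; allFin)
open import Data.List.Membership.Propositional using (lose) renaming (_∈_ to _∈ˡ_)
open import Data.List.Membership.Propositional.Properties
  using (∈-map⁺; ∈-map⁻; ∈-++⁺ˡ; ∈-++⁺ʳ; ∈-filter⁺; ∈-allFin)
open import Data.List.Properties using (filter-++; filter-none; filter-≐; length-++; length-map; length-tabulate)
open import Data.List.Relation.Unary.All as All using (All; []; _∷_)
import Data.List.Relation.Unary.All.Properties as All
open import Data.List.Relation.Unary.AllPairs as AllPairs using (AllPairs; []; _∷_)
import Data.List.Relation.Unary.AllPairs.Properties as AllPairs
open import Data.List.Relation.Unary.Any using (Any; here)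
import Data.List.Relation.Unary.Any.Properties as Any
open import Data.List.Relation.Unary.Unique.Propositional using (Unique)
import Data.List.Relation.Unary.Unique.Propositional.Properties as Unique
open import Data.Nat
  using (ℕ; zero; suc; pred; _+_; _∸_; _^_; _≤_; _<_; z≤n; s≤s; s≤s⁻¹; z<s; _≟_; _≤?_; _<?_; >-nonZero)
open import Data.Nat.Combinatorics using (_C_; nCk+nC[k+1]≡[n+1]C[k+1])
import Data.Nat.Coprimality as Coprime
open import Data.Nat.Properties
  using (+-assoc; +-comm; +-identityʳ; +-mono-≤; +-monoʳ-<; +-monoʳ-≤; +-∸-assoc; +-commutativeSemigroup;
         <-irrefl; <⇒≢; <⇒≤; <⇒≱; ≤-<-trans; ≤-antisym; ≤-refl; ≤-reflexive; ≤-trans; ≤⇒≯; ≤∧≢⇒<;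
         ≮⇒≥; ≰⇒>;
         suc-injective; suc-pred; n≮n; 0≢1+n; n≢0⇒n>0; n≤0⇒n≡0; n≤1+n; m≤n+m; m≤n⇒m≤1+n; pred[n]≤n;
         m>n⇒m∸n≢0; m∸[m∸n]≡n; m∸n≤m; m≤n⇒m∸n≡0; ∸-monoʳ-<; ∸-monoʳ-≤; module ≤-Reasoning)
open import Algebra.Properties.CommutativeSemigroup +-commutativeSemigroup using (x∙yz≈y∙xz; interchange)
open import Data.Product using (Σ; ∃; _×_; _,_; proj₁; proj₂; map₁)
open import Data.Rational as ℚ using (ℚ; mkℚ; 0ℚ; 1ℚ)
import Data.Rational.Properties as ℚₚ
open import Data.Rational.Solver using () renaming (module +-*-Solver to ℚSolver)
open import Data.Sum using (_⊎_; inj₁; inj₂; [_,_]′)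
import Data.Sum.Properties as ⊎
open import Data.Unit using (tt) renaming (⊤ to Unit)
open import Data.Vec using ([]; _∷_; here; there; lookup; tabulate)
open import Data.Vec.Functional using (updateAt)
open import Data.Vec.Functional.Properties using (updateAt-updates; updateAt-minimal)
import Data.Vec.Properties as Vec
open Vec using (∷-injectiveʳ; lookup∘tabulate; lookup⇒[]=; []=⇒lookup)
open import Function using (_∘_; const; id)
open import Function.Bundles using (Equivalence; mk⇔)
open import Relation.Binary.Definitions using (DecidableEquality)
open import Relation.Binary.PropositionalEquality
  using (_≡_; _≢_; refl; sym; trans; cong; cong₂; subst; subst₂; module ≡-Reasoning)
open import Relation.Nullary using (¬_; Dec; yes; no; contradiction)
open import Relation.Nullary.Decidable using (_×-dec_; _⊎-dec_; ¬?; does; dec-true)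
open import Relation.Unary using (Pred; Decidable)

open import Defs

private
  variable
    m n : ℕ

-- Sums of largest values

-- topSum n k = n + (n - 1) + ⋯ + (n - k + 1), with the terms below 1 dropped.
topSum : ℕ → ℕ → ℕ
topSum n       zero    = 0
topSum zero    (suc k) = 0
topSum (suc n) (suc k) = suc n + topSum n k

topSum-zeroˡ : ∀ k → topSum 0 k ≡ 0
topSum-zeroˡ zero    = refl
topSum-zeroˡ (suc k) = refl

topSum-suc : ∀ v k → topSum v (suc k) ≡ v + topSum (pred v) k
topSum-suc zero    k = sym (topSum-zeroˡ k)
topSum-suc (suc v) k = refl

topSum-pos : ∀ {n k} → 1 ≤ k → 0 < topSum (suc n) k
topSum-pos {k = suc k} _ = s≤s z≤n

topSum-monoˡ-≤ : ∀ n k → topSum n k ≤ topSum (suc n) k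
topSum-monoˡ-≤ n       zero    = z≤n
topSum-monoˡ-≤ zero    (suc k) = z≤n
topSum-monoˡ-≤ (suc n) (suc k) = s≤s (+-mono-≤ (n≤1+n n) (topSum-monoˡ-≤ n k))

topSum-monoˡ-< : ∀ n k → topSum n (suc k) < topSum (suc n) (suc k)
topSum-monoˡ-< zero    k = s≤s z≤n
topSum-monoˡ-< (suc n) k = s≤s (+-monoʳ-≤ (suc n) (topSum-monoˡ-≤ n k))

topSum-monoʳ-< : ∀ {n k l} → k < n → k < l → topSum n k < topSum n l
topSum-monoʳ-< {suc n} {zero}  {suc l} _         _         = s≤s z≤n
topSum-monoʳ-< {suc n} {suc k} {suc l} (s≤s k<n) (s≤s k<l) = +-monoʳ-< (suc n) (topSum-monoʳ-< k<n k<l)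

topSum-saturate : ∀ {n k} → n ≤ k → topSum n k ≡ topSum n n
topSum-saturate {zero}  {k}     _         = topSum-zeroˡ k
topSum-saturate {suc n} {suc k} (s≤s n≤k) = cong (suc n +_) (topSum-saturate n≤k)

-- Admissible vectors

NonzeroDistinct : (Fin m → ℕ) → Set
NonzeroDistinct x = ∀ i j → i ≢ j → x i ≢ 0 → x i ≢ x j

-- The value vectors of the generating words of P(m, n).
record Admissible (n : ℕ) (x : Fin m → ℕ) : Set where
  field
    distinct : NonzeroDistinct x
    bounded  : ∀ i → x i ≤ n

open Admissible

nonzeroDistinct-const0 : NonzeroDistinct {m} (const 0)
nonzeroDistinct-const0 _ _ _ x≢0 _ = x≢0 refl

admissible-const0 : Admissible {m} n (const 0)
admissible-const0 = record { distinct = nonzeroDistinct-const0 ; bounded = λ _ → z≤n }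

nonzeroDistinct-updateAt : ∀ {x : Fin m → ℕ} {v} i → NonzeroDistinct x →
                           (v ≢ 0 → ∀ k → k ≢ i → x k ≢ v) →
                           NonzeroDistinct (updateAt x i (const v))
nonzeroDistinct-updateAt {x = x} {v} i nd fresh k l k≢l yk≢0 yk≡yl with k ≟ᶠ i | l ≟ᶠ i
... | yes refl | yes refl = k≢l refl
... | yes refl | no  l≢i  = fresh (yk≢0 ∘ trans (updateAt-updates k x)) l l≢i
  (trans (sym (updateAt-minimal l k x l≢i)) (trans (sym yk≡yl) (updateAt-updates k x)))
... | no  k≢i  | yes refl = fresh (yk≢0 ∘ trans yk≡yl ∘ trans (updateAt-updates l x)) k k≢i
  (trans (sym (updateAt-minimal k l x k≢i)) (trans yk≡yl (updateAt-updates l x)))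
... | no  k≢i  | no  l≢i  = nd k l k≢l (yk≢0 ∘ trans (updateAt-minimal k i x k≢i))
  (trans (sym (updateAt-minimal k i x k≢i)) (trans yk≡yl (updateAt-minimal l i x l≢i)))

admissible-updateAt : ∀ {x : Fin m → ℕ} {v} i → Admissible n x → v ≤ n →
                      (v ≢ 0 → ∀ k → k ≢ i → x k ≢ v) → Admissible n (updateAt x i (const v))
admissible-updateAt {x = x} {v} i adm v≤n fresh = record
  { distinct = nonzeroDistinct-updateAt i (distinct adm) fresh
  ; bounded  = bounded′
  }
  where
  bounded′ : ∀ k → updateAt x i (const v) k ≤ _
  bounded′ k with k ≟ᶠ i
  ... | yes refl = subst (_≤ _) (sym (updateAt-updates k x)) v≤n
  ... | no  k≢i  = subst (_≤ _) (sym (updateAt-minimal k i x k≢i)) (bounded adm k)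

nonpeak-≤ : ∀ {x : Fin m → ℕ} {p i n} → NonzeroDistinct x → x p ≡ suc n → x i ≤ suc n → i ≢ p → x i ≤ n
nonpeak-≤ nd xp≡ xi≤ i≢p = s≤s⁻¹ (≤∧≢⇒< xi≤ λ xi≡ →
  nd _ _ (i≢p ∘ sym) (λ xp≡0 → 0≢1+n (trans (sym xp≡0) xp≡)) (trans xp≡ (sym xi≡)))

nonzeroDistinct-∘ : ∀ {x : Fin m → ℕ} {σ : Fin m → Fin m} →
                    (∀ {i j} → σ i ≡ σ j → i ≡ j) → NonzeroDistinct x → NonzeroDistinct (x ∘ σ)
nonzeroDistinct-∘ σ-inj nd i j i≢j = nd _ _ (i≢j ∘ σ-inj)

transpose-matchˡ : ∀ (i j : Fin m) → transpose i j i ≡ j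
transpose-matchˡ i j with i ≟ᶠ i
... | yes _   = refl
... | no  i≢i = contradiction refl i≢i

transpose-matchʳ : ∀ (i j : Fin m) → transpose i j j ≡ i
transpose-matchʳ i j with j ≟ᶠ i
... | yes j≡i = j≡i
... | no  _ with j ≟ᶠ j
...   | yes _   = refl
...   | no  j≢j = contradiction refl j≢j

transpose-other : ∀ {i j k : Fin m} → k ≢ i → k ≢ j → transpose i j k ≡ k
transpose-other {i = i} {j} {k} k≢i k≢j with k ≟ᶠ i
... | yes k≡i = contradiction k≡i k≢i
... | no  _ with k ≟ᶠ j
...   | yes k≡j = contradiction k≡j k≢j
...   | no  _   = refl

transpose≗updateAt : ∀ {a} {A : Set a} (x : Fin m → A) {i j k} → k ≢ j →
                     x (transpose i j k) ≡ updateAt x i (const (x j)) k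
transpose≗updateAt x {i} {j} {k} k≢j = by-cases (k ≟ᶠ i)
  where
  by-cases : Dec (k ≡ i) → x (transpose i j k) ≡ updateAt x i (const (x j)) k
  by-cases (yes refl) = trans (cong x (transpose-matchˡ k j)) (sym (updateAt-updates k x))
  by-cases (no  k≢i)  = trans (cong x (transpose-other k≢i k≢j)) (sym (updateAt-minimal k i x k≢i))

transpose-injective : ∀ (i j : Fin m) {k l} → transpose i j k ≡ transpose i j l → k ≡ l
transpose-injective i j {k} {l} eq =
  trans (sym (transpose-inverse j i)) (trans (cong (transpose j i) eq) (transpose-inverse j i))

admissible-transpose : ∀ {x : Fin m → ℕ} i j → Admissible n x → Admissible n (x ∘ transpose i j)
admissible-transpose i j adm = record
  { distinct = nonzeroDistinct-∘ (transpose-injective i j) (distinct adm)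
  ; bounded  = bounded adm ∘ transpose i j
  }

-- Sums over subsets

sumOver : Subset m → (Fin m → ℕ) → ℕ
sumOver []            x = 0
sumOver (inside  ∷ S) x = x zero + sumOver S (x ∘ suc)
sumOver (outside ∷ S) x = sumOver S (x ∘ suc)

sumOver-cong : ∀ (S : Subset m) {x y} → (∀ {i} → i ∈ S → x i ≡ y i) → sumOver S x ≡ sumOver S y
sumOver-cong []            eq = refl
sumOver-cong (inside  ∷ S) eq = cong₂ _+_ (eq here) (sumOver-cong S (eq ∘ there))
sumOver-cong (outside ∷ S) eq = sumOver-cong S (eq ∘ there)

sumOver-const0 : ∀ (S : Subset m) → sumOver S (const 0) ≡ 0
sumOver-const0 []            = refl
sumOver-const0 (inside  ∷ S) = sumOver-const0 S
sumOver-const0 (outside ∷ S) = sumOver-const0 S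

sumOver-⊥ : ∀ m (x : Fin m → ℕ) → sumOver ⊥ x ≡ 0
sumOver-⊥ zero    x = refl
sumOver-⊥ (suc m) x = sumOver-⊥ m (x ∘ suc)

sumOver-⁅⁆ : ∀ (i : Fin m) x → sumOver ⁅ i ⁆ x ≡ x i
sumOver-⁅⁆ {suc m} zero    x = trans (cong (x zero +_) (sumOver-⊥ m (x ∘ suc))) (+-identityʳ (x zero))
sumOver-⁅⁆         (suc i) x = sumOver-⁅⁆ i (x ∘ suc)

sumOver-mono-⊆ : ∀ {S T : Subset m} x → S ⊆ T → sumOver S x ≤ sumOver T x
sumOver-mono-⊆ {S = []}          {[]}          x S⊆T = z≤n
sumOver-mono-⊆ {S = inside  ∷ S} {inside  ∷ T} x S⊆T =
  +-monoʳ-≤ (x zero) (sumOver-mono-⊆ (x ∘ suc) (drop-∷-⊆ S⊆T))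
sumOver-mono-⊆ {S = inside  ∷ S} {outside ∷ T} x S⊆T = contradiction (S⊆T here) λ ()
sumOver-mono-⊆ {S = outside ∷ S} {inside  ∷ T} x S⊆T =
  ≤-trans (sumOver-mono-⊆ (x ∘ suc) (drop-∷-⊆ S⊆T)) (m≤n+m _ (x zero))
sumOver-mono-⊆ {S = outside ∷ S} {outside ∷ T} x S⊆T = sumOver-mono-⊆ (x ∘ suc) (drop-∷-⊆ S⊆T)

sumOver-≤-support : ∀ (S T : Subset m) {x} → (∀ {i} → i ∉ S → x i ≡ 0) → sumOver T x ≤ sumOver S x
sumOver-≤-support []            []            x₀ = z≤n
sumOver-≤-support (inside  ∷ S) (inside  ∷ T) x₀ = +-monoʳ-≤ _ (sumOver-≤-support S T (x₀ ∘ (_∘ drop-there)))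
sumOver-≤-support (inside  ∷ S) (outside ∷ T) x₀ =
  ≤-trans (sumOver-≤-support S T (x₀ ∘ (_∘ drop-there))) (m≤n+m _ _)
sumOver-≤-support (outside ∷ S) (inside  ∷ T) x₀ rewrite x₀ {zero} λ () =
  sumOver-≤-support S T (x₀ ∘ (_∘ drop-there))
sumOver-≤-support (outside ∷ S) (outside ∷ T) x₀ = sumOver-≤-support S T (x₀ ∘ (_∘ drop-there))

∉-remove : ∀ (S : Subset m) i → i ∉ S - i
∉-remove (s ∷ S) zero    ()
∉-remove (s ∷ S) (suc i) (there i∈) = ∉-remove S i i∈

∣-remove∣ : ∀ {S : Subset m} {i} → i ∈ S → ∣ S ∣ ≡ suc ∣ S - i ∣
∣-remove∣ {S = inside ∷ S}  here       = cong (suc ∘ ∣_∣) (sym (p─⊥≡p S))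
∣-remove∣ {S = inside ∷ S}  (there i∈) = cong suc (∣-remove∣ i∈)
∣-remove∣ {S = outside ∷ S} (there i∈) = ∣-remove∣ i∈

sumOver-remove : ∀ {S : Subset m} {i} x → i ∈ S → sumOver S x ≡ x i + sumOver (S - i) x
sumOver-remove {S = inside ∷ S}  x here       = cong (λ T → x zero + sumOver T (x ∘ suc)) (sym (p─⊥≡p S))
sumOver-remove {S = inside ∷ S}  x (there i∈) =
  trans (cong (x zero +_) (sumOver-remove (x ∘ suc) i∈)) (x∙yz≈y∙xz (x zero) (x (suc _)) _)
sumOver-remove {S = outside ∷ S} x (there i∈) = sumOver-remove (x ∘ suc) i∈

⊆-or-witness : ∀ (S T : Subset m) → S ⊆ T ⊎ ∃ λ j → j ∈ S × j ∉ T
⊆-or-witness S T with any? (λ j → j ∈? S ×-dec ¬? (j ∈? T))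
... | yes witness = inj₂ witness
... | no  none    = inj₁ λ {j} j∈S → decide j∈S (j ∈? T)
  where
  decide : ∀ {j} → j ∈ S → Dec (j ∈ T) → j ∈ T
  decide j∈S (yes j∈T) = j∈T
  decide j∈S (no  j∉T) = contradiction (_ , j∈S , j∉T) none

subsetOf : ∀ {p} {P : Pred (Fin m) p} → Decidable P → Subset m
subsetOf P? = tabulate (does ∘ P?)

∈-subsetOf⁺ : ∀ {p} {P : Pred (Fin m) p} (P? : Decidable P) {i} → P i → i ∈ subsetOf P?
∈-subsetOf⁺ P? {i} Pi = lookup⇒[]= i _ (trans (lookup∘tabulate _ i) (dec-true (P? i) Pi))

∈-subsetOf⁻ : ∀ {p} {P : Pred (Fin m) p} (P? : Decidable P) {i} → i ∈ subsetOf P? → P i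
∈-subsetOf⁻ P? {i} i∈ with P? i | trans (sym (lookup∘tabulate (does ∘ P?) i)) ([]=⇒lookup i∈)
... | yes Pi | _  = Pi
... | no  _  | ()

sumOver-topSum-zero : ∀ (S : Subset m) {x} → (∀ {i} → i ∈ S → x i ≤ 0) → sumOver S x ≡ topSum 0 ∣ S ∣
sumOver-topSum-zero S {x} x≤0 = begin
  sumOver S x         ≡⟨ sumOver-cong S (n≤0⇒n≡0 ∘ x≤0) ⟩
  sumOver S (const 0) ≡⟨ sumOver-const0 S ⟩
  0                   ≡⟨ topSum-zeroˡ ∣ S ∣ ⟨
  topSum 0 ∣ S ∣      ∎
  where open ≡-Reasoning

sumOver-≤-topSum : ∀ n (S : Subset m) {x} → NonzeroDistinct x → (∀ {i} → i ∈ S → x i ≤ n) →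
                   sumOver S x ≤ topSum n ∣ S ∣
sumOver-≤-topSum zero S _ x≤0 = ≤-reflexive (sumOver-topSum-zero S x≤0)
sumOver-≤-topSum (suc n) S {x} nd x≤ with any? (λ p → p ∈? S ×-dec x p ≟ suc n)
... | yes (p , p∈S , xp≡) = begin
  sumOver S x                      ≡⟨ sumOver-remove x p∈S ⟩
  x p + sumOver (S - p) x          ≤⟨ +-mono-≤ (≤-reflexive xp≡) (sumOver-≤-topSum n (S - p) nd below) ⟩
  suc n + topSum n ∣ S - p ∣        ≡⟨ cong (topSum (suc n)) (∣-remove∣ p∈S) ⟨
  topSum (suc n) ∣ S ∣              ∎
  where
  open ≤-Reasoning
  below : ∀ {i} → i ∈ S - p → x i ≤ n
  below {i} i∈ = nonpeak-≤ nd xp≡ (x≤ (p─q⊆p S ⁅ p ⁆ i∈)) λ { refl → ∉-remove S p i∈ }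
... | no no-peak = ≤-trans (sumOver-≤-topSum n S nd below) (topSum-monoˡ-≤ n ∣ S ∣)
  where
  below : ∀ {i} → i ∈ S → x i ≤ n
  below i∈ = s≤s⁻¹ (≤∧≢⇒< (x≤ i∈) λ xi≡ → no-peak (_ , i∈ , xi≡))

UpClosed : ℕ → Subset m → (Fin m → ℕ) → Set
UpClosed {m} n S x = ∀ {i} v → i ∈ S → x i < v → v ≤ n → ∃ λ (j : Fin m) → j ∈ S × x j ≡ v

sumOver-topSum-upClosed : ∀ n (S : Subset m) {x} → NonzeroDistinct x → (∀ {i} → i ∈ S → x i ≤ n) →
                          UpClosed n S x → sumOver S x ≡ topSum n ∣ S ∣
sumOver-topSum-upClosed zero S _ x≤0 _ = sumOver-topSum-zero S x≤0
sumOver-topSum-upClosed {m} (suc n) S {x} nd x≤ up with nonempty? S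
... | no empty = subst (λ T → sumOver T x ≡ topSum (suc n) ∣ T ∣) (sym (Empty-unique empty))
                   (trans (sumOver-⊥ m x) (cong (topSum (suc n)) (sym (∣⊥∣≡0 m))))
... | yes (i , i∈S) = remove-peak (peak (x i ≟ suc n))
  where
  peak : Dec (x i ≡ suc n) → ∃ λ p → p ∈ S × x p ≡ suc n
  peak (yes xi≡) = i , i∈S , xi≡
  peak (no  xi≢) = up (suc n) i∈S (≤∧≢⇒< (x≤ i∈S) xi≢) ≤-refl
  remove-peak : (∃ λ p → p ∈ S × x p ≡ suc n) → sumOver S x ≡ topSum (suc n) ∣ S ∣
  remove-peak (p , p∈S , xp≡) = begin
    sumOver S x                ≡⟨ sumOver-remove x p∈S ⟩
    x p + sumOver (S - p) x    ≡⟨ cong₂ _+_ xp≡ (sumOver-topSum-upClosed n (S - p) nd below up′) ⟩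
    suc n + topSum n ∣ S - p ∣  ≡⟨ cong (topSum (suc n)) (∣-remove∣ p∈S) ⟨
    topSum (suc n) ∣ S ∣        ∎
    where
    open ≡-Reasoning
    ≢p : ∀ {j} → j ∈ S - p → j ≢ p
    ≢p j∈ refl = ∉-remove S p j∈
    below : ∀ {j} → j ∈ S - p → x j ≤ n
    below j∈ = nonpeak-≤ nd xp≡ (x≤ (p─q⊆p S ⁅ p ⁆ j∈)) (≢p j∈)
    up′ : UpClosed n (S - p) x
    up′ v j∈ xj<v v≤n with up v (p─q⊆p S ⁅ p ⁆ j∈) xj<v (m≤n⇒m≤1+n v≤n)
    ... | k , k∈S , xk≡v =
      k , x∈p∧x≢y⇒x∈p-y k∈S (λ { refl → <-irrefl (trans (sym xk≡v) xp≡) (s≤s v≤n) }) , xk≡v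

-- Greedy vectors

greedy : Subset m → ℕ → Fin m → ℕ
greedy (inside  ∷ S) v zero    = v
greedy (outside ∷ S) v zero    = 0
greedy (inside  ∷ S) v (suc i) = greedy S (pred v) i
greedy (outside ∷ S) v (suc i) = greedy S v i

greedy-≤ : ∀ (S : Subset m) v i → greedy S v i ≤ v
greedy-≤ (inside  ∷ S) v zero    = ≤-refl
greedy-≤ (outside ∷ S) v zero    = z≤n
greedy-≤ (inside  ∷ S) v (suc i) = ≤-trans (greedy-≤ S (pred v) i) pred[n]≤n
greedy-≤ (outside ∷ S) v (suc i) = greedy-≤ S v i

greedy-∉ : ∀ (S : Subset m) v {i} → i ∉ S → greedy S v i ≡ 0
greedy-∉ (inside  ∷ S) v {zero}  i∉S = contradiction here i∉S
greedy-∉ (outside ∷ S) v {zero}  i∉S = refl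
greedy-∉ (inside  ∷ S) v {suc i} i∉S = greedy-∉ S (pred v) (i∉S ∘ there)
greedy-∉ (outside ∷ S) v {suc i} i∉S = greedy-∉ S v (i∉S ∘ there)

greedy-distinct : ∀ (S : Subset m) v → NonzeroDistinct (greedy S v)
greedy-distinct (s       ∷ S) v zero    zero    0≢0 = contradiction refl 0≢0
greedy-distinct (outside ∷ S) v zero    (suc j) _   = contradiction refl
greedy-distinct (outside ∷ S) v (suc i) zero    _   = λ gi≢0 gi≡0 → gi≢0 gi≡0
greedy-distinct (inside  ∷ S) zero    zero    (suc j) _ 0≢0 = contradiction refl 0≢0
greedy-distinct (inside  ∷ S) (suc v) zero    (suc j) _ _   = <⇒≢ (s≤s (greedy-≤ S v j)) ∘ sym
greedy-distinct (inside  ∷ S) zero    (suc i) zero    _ gi≢0 = contradiction (n≤0⇒n≡0 (greedy-≤ S 0 i)) gi≢0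
greedy-distinct (inside  ∷ S) (suc v) (suc i) zero    _ _   = <⇒≢ (s≤s (greedy-≤ S v i))
greedy-distinct (inside  ∷ S) v (suc i) (suc j) i≢j = greedy-distinct S (pred v) i j (i≢j ∘ cong suc)
greedy-distinct (outside ∷ S) v (suc i) (suc j) i≢j = greedy-distinct S v i j (i≢j ∘ cong suc)

sumOver-greedy : ∀ (S : Subset m) v → sumOver S (greedy S v) ≡ topSum v ∣ S ∣
sumOver-greedy []            v = refl
sumOver-greedy (inside  ∷ S) v = trans (cong (v +_) (sumOver-greedy S (pred v))) (sym (topSum-suc v ∣ S ∣))
sumOver-greedy (outside ∷ S) v = sumOver-greedy S v

greedy-> : ∀ {S : Subset m} {v i} → i ∈ S → ∣ S ∣ ≤ v → v ∸ ∣ S ∣ < greedy S v i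
greedy-> {S = inside  ∷ S} {suc v} here       _         = s≤s (m∸n≤m v ∣ S ∣)
greedy-> {S = inside  ∷ S} {suc v} (there i∈) (s≤s ≤v)  = greedy-> i∈ ≤v
greedy-> {S = outside ∷ S}         (there i∈) ≤v        = greedy-> i∈ ≤v

greedy-admissible : ∀ (S : Subset m) {v n} → v ≤ n → Admissible n (greedy S v)
greedy-admissible S {v} v≤n = record
  { distinct = greedy-distinct S v
  ; bounded  = λ i → ≤-trans (greedy-≤ S v i) v≤n
  }

pinned : Subset m → Fin m → ℕ → Fin m → ℕ
pinned S j v = updateAt (greedy (S - j) (pred v)) j (const v)

pinned-at : ∀ (S : Subset m) j v → pinned S j v j ≡ v
pinned-at S j v = updateAt-updates j (greedy (S - j) (pred v))

pinned-admissible : ∀ (S : Subset m) j {v n} → v ≤ n → Admissible n (pinned S j v)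
pinned-admissible S j {v} v≤n =
  admissible-updateAt j (greedy-admissible (S - j) (≤-trans pred[n]≤n v≤n)) v≤n (fresh v)
  where
  fresh : ∀ v → v ≢ 0 → ∀ k → k ≢ j → greedy (S - j) (pred v) k ≢ v
  fresh zero    v≢0 = contradiction refl v≢0
  fresh (suc v) _ k _ = <⇒≢ (s≤s (greedy-≤ (S - j) v k))

sumOver-pinned : ∀ {S : Subset m} {j} v → j ∈ S → sumOver S (pinned S j v) ≡ topSum v ∣ S ∣
sumOver-pinned {S = S} {j} v j∈S = begin
  sumOver S (pinned S j v)                               ≡⟨ sumOver-remove _ j∈S ⟩
  pinned S j v j + sumOver (S - j) (pinned S j v)         ≡⟨ cong₂ _+_ (pinned-at S j v) (sumOver-cong (S - j) off-j) ⟩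
  v + sumOver (S - j) (greedy (S - j) (pred v))           ≡⟨ cong (v +_) (sumOver-greedy (S - j) (pred v)) ⟩
  v + topSum (pred v) ∣ S - j ∣                           ≡⟨ topSum-suc v ∣ S - j ∣ ⟨
  topSum v (suc ∣ S - j ∣)                                ≡⟨ cong (topSum v) (∣-remove∣ j∈S) ⟨
  topSum v ∣ S ∣                                         ∎
  where
  open ≡-Reasoning
  off-j : ∀ {k} → k ∈ S - j → pinned S j v k ≡ greedy (S - j) (pred v) k
  off-j k∈ = updateAt-minimal _ j _ λ { refl → ∉-remove S j k∈ }

-- Candidate facets and separating vectors

-- coordinate i stands for the inequality -x_i ≤ 0, subset S for x(S) ≤ topSum n ∣ S ∣.
Candidate : ℕ → Set
Candidate m = Fin m ⊎ Subset m

pattern coordinate i = inj₁ i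
pattern subset S     = inj₂ S

ListedSize : ℕ → ℕ → ℕ → Set
ListedSize m n k = 1 ≤ k × (k < n ⊎ k ≡ m)

listedSize? : ∀ m n → Decidable (ListedSize m n)
listedSize? m n k = (1 ≤? k) ×-dec ((k <? n) ⊎-dec (k ≟ m))

Listed : ℕ → Candidate m → Set
Listed     n (coordinate i) = Unit
Listed {m} n (subset S)     = ListedSize m n ∣ S ∣

Tight : ℕ → Candidate m → (Fin m → ℕ) → Set
Tight n (coordinate i) x = x i ≡ 0
Tight n (subset S)     x = sumOver S x ≡ topSum n ∣ S ∣

sumOver-<-topSum : ∀ {n} (T : Subset m) {x j} → Admissible (suc n) x → x j ≡ suc n → j ∉ T → 1 ≤ ∣ T ∣ →
                   sumOver T x < topSum (suc n) ∣ T ∣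
sumOver-<-topSum {n = n} T {x} {j} adm xj≡ j∉T 1≤∣T∣ = begin-strict
  sumOver T x          ≤⟨ sumOver-≤-topSum n T (distinct adm) below ⟩
  topSum n ∣ T ∣
    <⟨ subst (λ k → topSum n k < topSum (suc n) k) (suc-pred ∣ T ∣ {{>-nonZero 1≤∣T∣}}) (topSum-monoˡ-< n _) ⟩
  topSum (suc n) ∣ T ∣ ∎
  where
  open ≤-Reasoning
  below : ∀ {i} → i ∈ T → x i ≤ n
  below i∈T = nonpeak-≤ (distinct adm) xj≡ (bounded adm _) λ { refl → j∉T i∈T }

const0-not-tight : ∀ n (T : Subset m) → 1 ≤ ∣ T ∣ → ¬ Tight (suc n) (subset T) (const 0)
const0-not-tight n T 1≤∣T∣ tight = <⇒≢ (topSum-pos 1≤∣T∣) (trans (sym (sumOver-const0 T)) tight)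

Separating : ℕ → Candidate m → Candidate m → Set
Separating {m} n a b = ∃ λ (x : Fin m → ℕ) → Admissible n x × Tight n a x × ¬ Tight n b x

pinned-separates : ∀ n {S : Subset m} {j} (b : Candidate m) → j ∈ S →
                   (pinned S j (suc n) j ≡ suc n → ¬ Tight (suc n) b (pinned S j (suc n))) →
                   Separating (suc n) (subset S) b
pinned-separates n {S} {j} b j∈S not-tight =
  pinned S j (suc n) , pinned-admissible S j ≤-refl , sumOver-pinned (suc n) j∈S , not-tight (pinned-at S j (suc n))

separate-coordinates : ∀ n {i j : Fin m} → i ≢ j → Separating (suc n) (coordinate i) (coordinate j)
separate-coordinates n {i} {j} i≢j =
  x , pinned-admissible ⁅ j ⁆ j ≤-refl , xi≡0 , λ xj≡0 → 0≢1+n (trans (sym xj≡0) (pinned-at ⁅ j ⁆ j (suc n)))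
  where
  x = pinned ⁅ j ⁆ j (suc n)
  xi≡0 : x i ≡ 0
  xi≡0 = trans (updateAt-minimal i j _ i≢j)
               (greedy-∉ (⁅ j ⁆ - j) n (x≢y⇒x∉⁅y⁆ i≢j ∘ p─q⊆p ⁅ j ⁆ ⁅ j ⁆))

separate-coordinate-subset : ∀ n (i : Fin m) T → 1 ≤ ∣ T ∣ → Separating (suc n) (coordinate i) (subset T)
separate-coordinate-subset n i T 1≤∣T∣ = const 0 , admissible-const0 , refl , const0-not-tight n T 1≤∣T∣

separate-subset-outside : ∀ n {S : Subset m} {i} → i ∉ S → ∣ S ∣ < suc n →
                          Separating (suc n) (subset S) (coordinate i)
separate-subset-outside n {S} {i} i∉S ∣S∣<n =
  x , admissible-updateAt i (greedy-admissible S ≤-refl) (m∸n≤m (suc n) ∣ S ∣) fresh , tight ,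
  v≢0 ∘ trans (sym (updateAt-updates i g))
  where
  g = greedy S (suc n)
  v = suc n ∸ ∣ S ∣
  x = updateAt g i (const v)
  v≢0 : v ≢ 0
  v≢0 = m>n⇒m∸n≢0 ∣S∣<n
  fresh : v ≢ 0 → ∀ k → k ≢ i → g k ≢ v
  fresh _ k _ with k ∈? S
  ... | yes k∈S = <⇒≢ (greedy-> k∈S (<⇒≤ ∣S∣<n)) ∘ sym
  ... | no  k∉S = λ gk≡v → v≢0 (trans (sym gk≡v) (greedy-∉ S (suc n) k∉S))
  tight : sumOver S x ≡ topSum (suc n) ∣ S ∣
  tight = trans (sumOver-cong S λ k∈S → updateAt-minimal _ i g λ { refl → i∉S k∈S }) (sumOver-greedy S (suc n))

-- If S ⊈ T, the top value placed at a point of S ∖ T is invisible to T; otherwise S ⊊ T and the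
-- greedy point of S is too small on T.
separate-subsets : ∀ n {S T : Subset m} → ∣ S ∣ < suc n ⊎ ∣ S ∣ ≡ m → 1 ≤ ∣ T ∣ → S ≢ T →
                   Separating (suc n) (subset S) (subset T)
separate-subsets {m} n {S} {T} small-or-full 1≤∣T∣ S≢T with ⊆-or-witness S T
... | inj₂ (j , j∈S , j∉T) = pinned-separates n (subset T) j∈S λ xj≡ tight →
  <⇒≢ (sumOver-<-topSum T (pinned-admissible S j ≤-refl) xj≡ j∉T 1≤∣T∣) tight
... | inj₁ S⊆T with ⊆-or-witness T S
...   | inj₁ T⊆S = contradiction (⊆-antisym S⊆T T⊆S) S≢T
...   | inj₂ (j , j∈T , j∉S) =
  greedy S (suc n) , greedy-admissible S ≤-refl , sumOver-greedy S (suc n) , λ tight →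
  <⇒≱ (topSum-monoʳ-< ∣S∣<n ∣S∣<∣T∣) (begin
    topSum (suc n) ∣ T ∣       ≡⟨ tight ⟨
    sumOver T (greedy S (suc n)) ≤⟨ sumOver-≤-support S T (greedy-∉ S (suc n)) ⟩
    sumOver S (greedy S (suc n)) ≡⟨ sumOver-greedy S (suc n) ⟩
    topSum (suc n) ∣ S ∣       ∎)
  where
  open ≤-Reasoning
  ∣S∣<∣T∣ : ∣ S ∣ < ∣ T ∣
  ∣S∣<∣T∣ = p⊂q⇒∣p∣<∣q∣ (S⊆T , j , j∈T , j∉S)
  ∣S∣<n : ∣ S ∣ < suc n
  ∣S∣<n = [ id , (λ ∣S∣≡m → contradiction (subst (_< ∣ T ∣) ∣S∣≡m ∣S∣<∣T∣) (≤⇒≯ (∣p∣≤n T))) ]′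
            small-or-full

separate : ∀ n (a b : Candidate m) → Listed (suc n) a → Listed (suc n) b → a ≢ b → Separating (suc n) a b
separate n (coordinate i) (coordinate j) _ _ a≢b = separate-coordinates n (a≢b ∘ cong coordinate)
separate n (coordinate i) (subset T) _ (1≤∣T∣ , _) _ = separate-coordinate-subset n i T 1≤∣T∣
separate n (subset S) (coordinate i) (_ , small-or-full) _ _ with i ∈? S | small-or-full
... | yes i∈S | _ = pinned-separates n (coordinate i) i∈S λ xi≡ xi≡0 → 0≢1+n (trans (sym xi≡0) xi≡)
... | no  i∉S | inj₁ ∣S∣<n = separate-subset-outside n i∉S ∣S∣<n
... | no  i∉S | inj₂ ∣S∣≡m = contradiction (subst (i ∈_) (sym (∣p∣≡n⇒p≡⊤ ∣S∣≡m)) ∈⊤) i∉S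
separate n (subset S) (subset T) (_ , small-or-full) (1≤∣T∣ , _) a≢b =
  separate-subsets n small-or-full 1≤∣T∣ (a≢b ∘ cong subset)

module _ {c ℓ} (M : CommutativeMonoid c ℓ) where
  open CommutativeMonoid M
    using (_≈_; _∙_; setoid; ∙-cong; ∙-congˡ; ∙-congʳ; assoc; comm; commutativeSemigroup)
    renaming (Carrier to A)
  open Sum M using (sum; sum-cong-≋)
  open import Algebra.Properties.CommutativeSemigroup commutativeSemigroup using (xy∙z≈xz∙y; x∙yz≈y∙xz)
  open import Relation.Binary.Reasoning.Setoid setoid

  sum-changeAt : ∀ {m} (i : Fin m) (f g : Fin m → A) → (∀ k → k ≢ i → g k ≈ f k) →
                 sum g ∙ f i ≈ sum f ∙ g i
  sum-changeAt {suc m} zero f g g≈f = begin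
    (g zero ∙ sum (g ∘ suc)) ∙ f zero ≈⟨ xy∙z≈xz∙y _ _ _ ⟩
    (g zero ∙ f zero) ∙ sum (g ∘ suc) ≈⟨ ∙-congˡ (sum-cong-≋ λ k → g≈f (suc k) λ ()) ⟩
    (g zero ∙ f zero) ∙ sum (f ∘ suc) ≈⟨ ∙-congʳ (comm _ _) ⟩
    (f zero ∙ g zero) ∙ sum (f ∘ suc) ≈⟨ xy∙z≈xz∙y _ _ _ ⟩
    (f zero ∙ sum (f ∘ suc)) ∙ g zero ∎
  sum-changeAt {suc m} (suc i) f g g≈f = begin
    (g zero ∙ sum (g ∘ suc)) ∙ f (suc i) ≈⟨ assoc _ _ _ ⟩
    g zero ∙ (sum (g ∘ suc) ∙ f (suc i)) ≈⟨ ∙-cong (g≈f zero λ ()) (sum-changeAt i (f ∘ suc) (g ∘ suc) g≈f′) ⟩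
    f zero ∙ (sum (f ∘ suc) ∙ g (suc i)) ≈⟨ assoc _ _ _ ⟨
    (f zero ∙ sum (f ∘ suc)) ∙ g (suc i) ∎
    where
    g≈f′ : ∀ k → k ≢ i → g (suc k) ≈ f (suc k)
    g≈f′ k k≢i = g≈f (suc k) (k≢i ∘ FinP.suc-injective)

toℚ : ℕ → ℚ
toℚ k = ℤ.+ k ℚ./ 1

toℚ-normal : ∀ k → toℚ k ≡ mkℚ (ℤ.+ k) 0 (Coprime.sym (Coprime.1-coprimeTo k))
toℚ-normal k = ℚₚ.normalize-coprime (Coprime.sym (Coprime.1-coprimeTo k))

toℚ-+ : ∀ a b → toℚ (a + b) ≡ toℚ a ℚ.+ toℚ b
toℚ-+ a b rewrite toℚ-normal a | toℚ-normal b =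
  cong (ℚ._/ 1) (sym (cong₂ ℤ._+_ (ℤₚ.*-identityʳ (ℤ.+ a)) (ℤₚ.*-identityʳ (ℤ.+ b))))

toℚ-injective : ∀ {a b} → toℚ a ≡ toℚ b → a ≡ b
toℚ-injective {a} {b} eq = ℤₚ.+-injective (begin
  ℤ.+ a           ≡⟨ cong ℚ.↥_ (toℚ-normal a) ⟨
  ℚ.↥ (toℚ a)     ≡⟨ cong ℚ.↥_ eq ⟩
  ℚ.↥ (toℚ b)     ≡⟨ cong ℚ.↥_ (toℚ-normal b) ⟩
  ℤ.+ b           ∎)
  where open ≡-Reasoning

toℚ-mono-≤ : ∀ {a b} → a ≤ b → toℚ a ℚ.≤ toℚ b
toℚ-mono-≤ {a} {b} a≤b rewrite toℚ-normal a | toℚ-normal b =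
  ℚ.*≤* (subst₂ ℤ._≤_ (sym (ℤₚ.*-identityʳ (ℤ.+ a))) (sym (ℤₚ.*-identityʳ (ℤ.+ b))) (ℤ.+≤+ a≤b))

toℚ-mono-< : ∀ {a b} → a < b → toℚ a ℚ.< toℚ b
toℚ-mono-< {a} {b} a<b rewrite toℚ-normal a | toℚ-normal b =
  ℚ.*<* (subst₂ ℤ._<_ (sym (ℤₚ.*-identityʳ (ℤ.+ a))) (sym (ℤₚ.*-identityʳ (ℤ.+ b))) (ℤ.+<+ a<b))

module ℚΣ = Sum ℚₚ.+-0-commutativeMonoid

sumFin≡sum : ∀ m f → sumFin m f ≡ ℚΣ.sum f
sumFin≡sum zero    f = refl
sumFin≡sum (suc m) f = cong (f zero ℚ.+_) (sumFin≡sum m (f ∘ suc))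

infix 7 _·_
_·_ : (Fin m → ℚ) → (Fin m → ℕ) → ℚ
c · x = ℚΣ.sum (λ i → c i ℚ.* toℚ (x i))

·-changeAt : ∀ (i : Fin m) c {x y} → (∀ k → k ≢ i → y k ≡ x k) →
             c · y ℚ.+ c i ℚ.* toℚ (x i) ≡ c · x ℚ.+ c i ℚ.* toℚ (y i)
·-changeAt i c y≡x =
  sum-changeAt ℚₚ.+-0-commutativeMonoid i _ _ λ k k≢i → cong (λ v → c k ℚ.* toℚ v) (y≡x k k≢i)

·-zeroˡ : ∀ {c : Fin m → ℚ} x → (∀ i → c i ≡ 0ℚ) → c · x ≡ 0ℚ
·-zeroˡ {m} x c≡0 = trans (ℚΣ.sum-cong-≗ λ i → trans (cong (ℚ._* toℚ (x i)) (c≡0 i)) (ℚₚ.*-zeroˡ (toℚ (x i))))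
                          (ℚΣ.sum-replicate-zero m)

·-transpose : ∀ (c : Fin m → ℚ) x {i j} → i ≢ j →
              c · (x ∘ transpose i j) ℚ.+ (c j ℚ.* toℚ (x j) ℚ.+ c i ℚ.* toℚ (x i)) ≡
              c · x ℚ.+ (c j ℚ.* toℚ (x i) ℚ.+ c i ℚ.* toℚ (x j))
·-transpose c x {i} {j} i≢j = begin
  c · x′ ℚ.+ (c j ℚ.* toℚ (x j) ℚ.+ c i ℚ.* toℚ (x i)) ≡⟨ ℚₚ.+-assoc (c · x′) _ _ ⟨
  c · x′ ℚ.+ c j ℚ.* toℚ (x j) ℚ.+ c i ℚ.* toℚ (x i)   ≡⟨ cong (ℚ._+ c i ℚ.* toℚ (x i)) step-j ⟩
  c · y ℚ.+ c j ℚ.* toℚ (x i) ℚ.+ c i ℚ.* toℚ (x i)    ≡⟨ xy∙z≈xz∙y (c · y) _ _ ⟩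
  c · y ℚ.+ c i ℚ.* toℚ (x i) ℚ.+ c j ℚ.* toℚ (x i)    ≡⟨ cong (ℚ._+ c j ℚ.* toℚ (x i)) step-i ⟩
  c · x ℚ.+ c i ℚ.* toℚ (x j) ℚ.+ c j ℚ.* toℚ (x i)    ≡⟨ xy∙z≈x∙zy (c · x) _ _ ⟩
  c · x ℚ.+ (c j ℚ.* toℚ (x i) ℚ.+ c i ℚ.* toℚ (x j))  ∎
  where
  open ≡-Reasoning
  open import Algebra.Properties.CommutativeSemigroup
    (CommutativeMonoid.commutativeSemigroup ℚₚ.+-0-commutativeMonoid) using (xy∙z≈xz∙y; xy∙z≈x∙zy)
  x′ = x ∘ transpose i j
  y  = updateAt x i (const (x j))
  step-j : c · x′ ℚ.+ c j ℚ.* toℚ (x j) ≡ c · y ℚ.+ c j ℚ.* toℚ (x i)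
  step-j = begin
    c · x′ ℚ.+ c j ℚ.* toℚ (x j)  ≡⟨ cong (λ v → c · x′ ℚ.+ c j ℚ.* toℚ v) (updateAt-minimal j i x (i≢j ∘ sym)) ⟨
    c · x′ ℚ.+ c j ℚ.* toℚ (y j)  ≡⟨ ·-changeAt j c (λ k → transpose≗updateAt x) ⟩
    c · y ℚ.+ c j ℚ.* toℚ (x′ j)  ≡⟨ cong (λ k → c · y ℚ.+ c j ℚ.* toℚ (x k)) (transpose-matchʳ i j) ⟩
    c · y ℚ.+ c j ℚ.* toℚ (x i)   ∎
  step-i : c · y ℚ.+ c i ℚ.* toℚ (x i) ≡ c · x ℚ.+ c i ℚ.* toℚ (x j)
  step-i = trans (·-changeAt i c λ k k≢i → updateAt-minimal k i x k≢i)
                 (cong (λ v → c · x ℚ.+ c i ℚ.* toℚ v) (updateAt-updates i x))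

indicator : Subset m → ℚ → Fin m → ℚ
indicator S q j = if lookup S j then q else 0ℚ

indicator-· : ∀ (S : Subset m) q x → indicator S q · x ≡ q ℚ.* toℚ (sumOver S x)
indicator-· []            q x = sym (ℚₚ.*-zeroʳ q)
indicator-· (inside  ∷ S) q x = begin
  q ℚ.* toℚ (x zero) ℚ.+ indicator S q · (x ∘ suc)        ≡⟨ cong (q ℚ.* toℚ (x zero) ℚ.+_) (indicator-· S q _) ⟩
  q ℚ.* toℚ (x zero) ℚ.+ q ℚ.* toℚ (sumOver S (x ∘ suc)) ≡⟨ ℚₚ.*-distribˡ-+ q (toℚ (x zero)) _ ⟨
  q ℚ.* (toℚ (x zero) ℚ.+ toℚ (sumOver S (x ∘ suc)))    ≡⟨ cong (q ℚ.*_) (toℚ-+ (x zero) _) ⟨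
  q ℚ.* toℚ (x zero + sumOver S (x ∘ suc))               ∎
  where open ≡-Reasoning
indicator-· (outside ∷ S) q x = begin
  0ℚ ℚ.* toℚ (x zero) ℚ.+ indicator S q · (x ∘ suc)
    ≡⟨ cong (ℚ._+ indicator S q · (x ∘ suc)) (ℚₚ.*-zeroˡ (toℚ (x zero))) ⟩
  0ℚ ℚ.+ indicator S q · (x ∘ suc)                  ≡⟨ ℚₚ.+-identityˡ (indicator S q · (x ∘ suc)) ⟩
  indicator S q · (x ∘ suc)                         ≡⟨ indicator-· S q (x ∘ suc) ⟩
  q ℚ.* toℚ (sumOver S (x ∘ suc))                   ∎
  where open ≡-Reasoning

rearrangement : ∀ {a b p q} → a ℚ.< b → p ℚ.< q → a ℚ.* q ℚ.+ b ℚ.* p ℚ.< a ℚ.* p ℚ.+ b ℚ.* q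
rearrangement {a} {b} {p} {q} a<b p<q = begin-strict
  a ℚ.* q ℚ.+ b ℚ.* p                                  ≡⟨ ℚₚ.+-identityʳ (a ℚ.* q ℚ.+ b ℚ.* p) ⟨
  a ℚ.* q ℚ.+ b ℚ.* p ℚ.+ 0ℚ                           <⟨ ℚₚ.+-monoʳ-< (a ℚ.* q ℚ.+ b ℚ.* p) positive-gap ⟩
  a ℚ.* q ℚ.+ b ℚ.* p ℚ.+ (b ℚ.- a) ℚ.* (q ℚ.- p)
    ≡⟨ solve 4 (λ a b p q → a :* q :+ b :* p :+ (b :- a) :* (q :- p) := a :* p :+ b :* q) refl a b p q ⟩
  a ℚ.* p ℚ.+ b ℚ.* q                                  ∎
  where
  open ℚₚ.≤-Reasoning
  open ℚSolver
  0<gap : ∀ {r s} → r ℚ.< s → 0ℚ ℚ.< s ℚ.- r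
  0<gap {r} {s} r<s = subst (ℚ._< s ℚ.- r) (ℚₚ.+-inverseʳ r) (ℚₚ.+-monoˡ-< (ℚ.- r) r<s)
  positive-gap : 0ℚ ℚ.< (b ℚ.- a) ℚ.* (q ℚ.- p)
  positive-gap = ℚₚ.positive⁻¹ ((b ℚ.- a) ℚ.* (q ℚ.- p))
    {{ℚₚ.pos*pos⇒pos (b ℚ.- a) {{ℚ.positive (0<gap a<b)}} (q ℚ.- p) {{ℚ.positive (0<gap p<q)}}}}

≤∧≢⇒<ℚ : ∀ {p q} → p ℚ.≤ q → p ≢ q → p ℚ.< q
≤∧≢⇒<ℚ {p} {q} p≤q p≢q with p ℚ.<? q
... | yes p<q = p<q
... | no  p≮q = contradiction (ℚₚ.≤-antisym p≤q (ℚₚ.≮⇒≥ p≮q)) p≢q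

values : Word m n → Fin m → ℕ
values w = toℕ ∘ w

dot≡· : ∀ (c : Fin m → ℚ) (w : Word m n) → dot c w ≡ c · values w
dot≡· {m} c w = sumFin≡sum m _

admissible-values : ∀ {w : Word m n} → Valid w → Admissible n (values w)
admissible-values {w = w} valid = record
  { distinct = λ i j i≢j wi≢0 → valid i j i≢j wi≢0 ∘ toℕ-injective
  ; bounded  = λ i → s≤s⁻¹ (toℕ<n (w i))
  }

toWord : ∀ {x : Fin m → ℕ} → Admissible n x → Word m n
toWord adm i = fromℕ< (s≤s (bounded adm i))

values-toWord : ∀ {x : Fin m → ℕ} (adm : Admissible n x) i → values (toWord adm) i ≡ x i
values-toWord adm i = toℕ-fromℕ< (s≤s (bounded adm i))

toWord-valid : ∀ {x : Fin m → ℕ} (adm : Admissible n x) → Valid (toWord adm)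
toWord-valid adm i j i≢j wi≢0 wi≡wj = distinct adm i j i≢j (wi≢0 ∘ trans (values-toWord adm i))
  (trans (sym (values-toWord adm i)) (trans (cong toℕ wi≡wj) (values-toWord adm j)))

supporting-admissible : ∀ {c : Fin m → ℚ} {b x} → Supporting {m} {n} (c , b) → Admissible n x →
                        c · x ℚ.≤ b
supporting-admissible {c = c} supp adm = subst (ℚ._≤ _)
  (trans (dot≡· c (toWord adm)) (ℚΣ.sum-cong-≗ λ i → cong (λ v → c i ℚ.* toℚ v) (values-toWord adm i)))
  (supp (toWord adm) (toWord-valid adm))

-- Faces cut out by the candidates

ineq : ℕ → Candidate m → Ineq m
ineq n (coordinate i) = indicator ⁅ i ⁆ (ℚ.- 1ℚ) , 0ℚ
ineq n (subset S)     = indicator S 1ℚ , toℚ (topSum n ∣ S ∣)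

coordinate-· : ∀ (i : Fin m) x → indicator ⁅ i ⁆ (ℚ.- 1ℚ) · x ≡ ℚ.- toℚ (x i)
coordinate-· i x = begin
  indicator ⁅ i ⁆ (ℚ.- 1ℚ) · x              ≡⟨ indicator-· ⁅ i ⁆ (ℚ.- 1ℚ) x ⟩
  ℚ.- 1ℚ ℚ.* toℚ (sumOver ⁅ i ⁆ x)         ≡⟨ cong (λ k → ℚ.- 1ℚ ℚ.* toℚ k) (sumOver-⁅⁆ i x) ⟩
  ℚ.- 1ℚ ℚ.* toℚ (x i)                     ≡⟨ ℚₚ.neg-distribˡ-* 1ℚ (toℚ (x i)) ⟨
  ℚ.- (1ℚ ℚ.* toℚ (x i))                   ≡⟨ cong ℚ.-_ (ℚₚ.*-identityˡ (toℚ (x i))) ⟩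
  ℚ.- toℚ (x i)                            ∎
  where open ≡-Reasoning

subset-· : ∀ (S : Subset m) x → indicator S 1ℚ · x ≡ toℚ (sumOver S x)
subset-· S x = trans (indicator-· S 1ℚ x) (ℚₚ.*-identityˡ _)

tight⁺ : ∀ n (a : Candidate m) {x} → Tight n a x → proj₁ (ineq n a) · x ≡ proj₂ (ineq n a)
tight⁺ n (coordinate i) {x} xi≡0  = trans (coordinate-· i x) (cong (ℚ.-_ ∘ toℚ) xi≡0)
tight⁺ n (subset S)     {x} tight = trans (subset-· S x) (cong toℚ tight)

tight⁻ : ∀ n (a : Candidate m) {x} → proj₁ (ineq n a) · x ≡ proj₂ (ineq n a) → Tight n a x
tight⁻ n (coordinate i) {x} eq = toℚ-injective (ℚₚ.neg-injective (trans (sym (coordinate-· i x)) eq))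
tight⁻ n (subset S)     {x} eq = toℚ-injective (trans (sym (subset-· S x)) eq)

onFace⁺ : ∀ n (a : Candidate m) {w : Word m n} → Valid w → Tight n a (values w) → OnFace {m} {n} (ineq n a) w
onFace⁺ n a {w} valid tight = valid , trans (dot≡· (proj₁ (ineq n a)) w) (tight⁺ n a tight)

onFace⁻ : ∀ n (a : Candidate m) {w : Word m n} → OnFace {m} {n} (ineq n a) w → Tight n a (values w)
onFace⁻ n a {w} (_ , eq) = tight⁻ n a (trans (sym (dot≡· (proj₁ (ineq n a)) w)) eq)

tight-cong : ∀ n (a : Candidate m) {x y} → (∀ i → x i ≡ y i) → Tight n a x → Tight n a y
tight-cong n (coordinate i) x≗y tight = trans (sym (x≗y i)) tight
tight-cong n (subset S)     x≗y tight = trans (sumOver-cong S λ {i} _ → sym (x≗y i)) tight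

onFace-toWord : ∀ n (a : Candidate m) {x} (adm : Admissible n x) → Tight n a x →
                OnFace {m} {n} (ineq n a) (toWord adm)
onFace-toWord n a adm tight = onFace⁺ n a (toWord-valid adm) (tight-cong n a (sym ∘ values-toWord adm) tight)

onFace-toWord⁻ : ∀ n (a : Candidate m) {x} (adm : Admissible n x) → OnFace {m} {n} (ineq n a) (toWord adm) →
                 Tight n a x
onFace-toWord⁻ n a adm = tight-cong n a (values-toWord adm) ∘ onFace⁻ n a

separating-word : ∀ n (a b : Candidate m) → Separating n a b →
                  ∃ λ (w : Word m n) → OnFace {m} {n} (ineq n a) w × ¬ OnFace {m} {n} (ineq n b) w
separating-word n a b (x , adm , tight-a , ¬tight-b) =
  toWord adm , onFace-toWord n a adm tight-a , ¬tight-b ∘ onFace-toWord⁻ n b adm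

candidate-supporting : ∀ n (a : Candidate m) → Supporting {m} {n} (ineq n a)
candidate-supporting n (coordinate i) w valid =
  subst (ℚ._≤ 0ℚ) (sym (trans (dot≡· (indicator ⁅ i ⁆ (ℚ.- 1ℚ)) w) (coordinate-· i (values w))))
    (ℚₚ.neg-antimono-≤ (toℚ-mono-≤ {0} {values w i} z≤n))
candidate-supporting n (subset S) w valid =
  subst (ℚ._≤ toℚ (topSum n ∣ S ∣)) (sym (trans (dot≡· (indicator S 1ℚ) w) (subset-· S (values w))))
    (toℚ-mono-≤ (sumOver-≤-topSum n S (distinct adm) λ _ → bounded adm _))
  where adm = admissible-values valid

tight-witness : ∀ n (a : Candidate m) → ∃ λ x → Admissible n x × Tight n a x
tight-witness n (coordinate i) = const 0 , admissible-const0 , refl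
tight-witness n (subset S)     = greedy S n , greedy-admissible S ≤-refl , sumOver-greedy S n

not-tight-witness : ∀ n (a : Candidate m) → Listed (suc n) a →
                    ∃ λ x → Admissible (suc n) x × ¬ Tight (suc n) a x
not-tight-witness n (coordinate i) _ = pinned ⁅ i ⁆ i (suc n) , pinned-admissible ⁅ i ⁆ i ≤-refl ,
  λ xi≡0 → 0≢1+n (trans (sym xi≡0) (pinned-at ⁅ i ⁆ i (suc n)))
not-tight-witness n (subset T) (1≤∣T∣ , _) = const 0 , admissible-const0 , const0-not-tight n T 1≤∣T∣

candidate-face : ∀ n (a : Candidate m) → IsFace {m} {n} (ineq n a)
candidate-face n a with tight-witness n a
... | x , adm , tight = candidate-supporting n a , toWord adm , onFace-toWord n a adm tight

candidate-proper : ∀ n (a : Candidate m) → Listed (suc n) a → Proper {m} {suc n} (ineq (suc n) a)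
candidate-proper n a listed with not-tight-witness n a listed
... | x , adm , ¬tight = toWord adm , valid ,
  ≤∧≢⇒<ℚ (candidate-supporting (suc n) a _ valid) (¬tight ∘ onFace-toWord⁻ (suc n) a adm ∘ (valid ,_))
  where valid = toWord-valid adm

-- Every proper face lies in a candidate face

argmax : ∀ (c : Fin (suc m) → ℚ) → ∃ λ i → ∀ j → c j ℚ.≤ c i
argmax {zero}  c = zero , λ { zero → ℚₚ.≤-refl }
argmax {suc m} c with argmax (c ∘ suc)
... | i , c≤ci with c zero ℚ.≤? c (suc i)
...   | yes c0≤ci = suc i , λ { zero → c0≤ci ; (suc j) → c≤ci j }
...   | no  c0≰ci = zero  , λ { zero → ℚₚ.≤-refl
                              ; (suc j) → ℚₚ.≤-trans (c≤ci j) (ℚₚ.<⇒≤ (ℚₚ.≰⇒> c0≰ci)) }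

module TightPoint {c : Fin m → ℚ} {b} (supp : Supporting {m} {n} (c , b))
                  {x} (adm : Admissible n x) (x-tight : c · x ≡ b) where

  no-improvement : ∀ {x′} → Admissible n x′ → ∀ {p q} → c · x′ ℚ.+ p ≡ c · x ℚ.+ q → ¬ (p ℚ.< q)
  no-improvement {x′} adm′ {p} {q} eq p<q = ℚₚ.<-irrefl refl (begin-strict
    c · x ℚ.+ p   <⟨ ℚₚ.+-monoʳ-< (c · x) p<q ⟩
    c · x ℚ.+ q   ≡⟨ eq ⟨
    c · x′ ℚ.+ p  ≤⟨ ℚₚ.+-monoˡ-≤ p (supporting-admissible {c = c} {b} supp adm′) ⟩
    b ℚ.+ p       ≡⟨ cong (ℚ._+ p) x-tight ⟨
    c · x ℚ.+ p   ∎)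
    where open ℚₚ.≤-Reasoning

  no-improvement-at : ∀ i {v} → v ≤ n → (v ≢ 0 → ∀ k → k ≢ i → x k ≢ v) →
                      ¬ (c i ℚ.* toℚ (x i) ℚ.< c i ℚ.* toℚ v)
  no-improvement-at i {v} v≤n fresh = no-improvement (admissible-updateAt i adm v≤n fresh)
    (trans (·-changeAt i c λ k k≢i → updateAt-minimal k i x k≢i)
           (cong (λ u → c · x ℚ.+ c i ℚ.* toℚ u) (updateAt-updates i x)))

  zero-where-negative : ∀ i → c i ℚ.< 0ℚ → x i ≡ 0
  zero-where-negative i ci<0 with x i ≟ 0
  ... | yes xi≡0 = xi≡0
  ... | no  xi≢0 = contradiction (ℚₚ.*-monoʳ-<-neg (c i) {{ℚ.negative ci<0}} (toℚ-mono-< (n≢0⇒n>0 xi≢0)))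
                     (no-improvement-at i z≤n λ 0≢0 → contradiction refl 0≢0)

  -- Raising x_i to an unused value v, or exchanging x_i with the value v held at a smaller
  -- coefficient, would increase c · x.
  upClosed-at-max : ∀ {M} → 0ℚ ℚ.< M → (∀ j → c j ℚ.≤ M) → UpClosed n (subsetOf (λ j → c j ℚ.≟ M)) x
  upClosed-at-max {M} 0<M c≤M {i} v i∈T xi<v v≤n with any? (λ j → x j ≟ v)
  ... | no  unused =
    contradiction (ℚₚ.*-monoʳ-<-pos (c i) {{ℚ.positive (subst (0ℚ ℚ.<_) (sym ci≡M) 0<M)}} (toℚ-mono-< xi<v))
                  (no-improvement-at i v≤n λ _ k _ xk≡v → unused (k , xk≡v))
    where ci≡M = ∈-subsetOf⁻ (λ j → c j ℚ.≟ M) i∈T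
  ... | yes (j , xj≡v) with c j ℚ.≟ M
  ...   | yes cj≡M = j , ∈-subsetOf⁺ (λ j → c j ℚ.≟ M) cj≡M , xj≡v
  ...   | no  cj≢M = contradiction (rearrangement cj<ci xi<xj)
                                   (no-improvement (admissible-transpose i j adm) (·-transpose c x i≢j))
    where
    ci≡M = ∈-subsetOf⁻ (λ j → c j ℚ.≟ M) i∈T
    cj<ci : c j ℚ.< c i
    cj<ci = subst (c j ℚ.<_) (sym ci≡M) (≤∧≢⇒<ℚ (c≤M j) cj≢M)
    xi<xj : toℚ (x i) ℚ.< toℚ (x j)
    xi<xj = toℚ-mono-< (subst (x i <_) (sym xj≡v) xi<v)
    i≢j : i ≢ j
    i≢j refl = <-irrefl refl (subst (x i <_) (sym xj≡v) xi<v)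

module MaxSet {c : Fin m → ℚ} {b} n (supp : Supporting {m} {n} (c , b))
              {i} (0<ci : 0ℚ ℚ.< c i) (c≤ci : ∀ j → c j ℚ.≤ c i) where

  T : Subset m
  T = subsetOf (λ j → c j ℚ.≟ c i)

  1≤∣T∣ : 1 ≤ ∣ T ∣
  1≤∣T∣ = ≤-<-trans z≤n (x∈p⇒∣p-x∣<∣p∣ (∈-subsetOf⁺ (λ j → c j ℚ.≟ c i) refl))

  ∣T∣≤∣⊤∣ : ∣ T ∣ ≤ ∣ ⊤ {m} ∣
  ∣T∣≤∣⊤∣ = p⊆q⇒∣p∣≤∣q∣ (⊆⊤ {p = T})

  tight-T : ∀ {w : Word m n} → OnFace {m} {n} (c , b) w → sumOver T (values w) ≡ topSum n ∣ T ∣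
  tight-T {w} (valid , on) =
    sumOver-topSum-upClosed n T (distinct adm) (λ _ → bounded adm _) (upClosed-at-max 0<ci c≤ci)
    where
    adm = admissible-values valid
    open TightPoint {c = c} {b} supp adm (trans (sym (dot≡· c w)) on)

  tight-⊤ : n ≤ ∣ T ∣ → ∀ {w : Word m n} → OnFace {m} {n} (c , b) w →
            sumOver ⊤ (values w) ≡ topSum n ∣ ⊤ {m} ∣
  tight-⊤ n≤∣T∣ {w} on@(valid , _) = ≤-antisym
    (sumOver-≤-topSum n ⊤ (distinct adm) λ _ → bounded adm _)
    (begin
      topSum n ∣ ⊤ {m} ∣      ≡⟨ topSum-saturate (≤-trans n≤∣T∣ ∣T∣≤∣⊤∣) ⟩
      topSum n n             ≡⟨ topSum-saturate n≤∣T∣ ⟨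
      topSum n ∣ T ∣          ≡⟨ tight-T on ⟨
      sumOver T (values w)   ≤⟨ sumOver-mono-⊆ (values w) (⊆⊤ {p = T}) ⟩
      sumOver ⊤ (values w)   ∎)
    where
    open ≤-Reasoning
    adm = admissible-values valid

  candidate : ∃ λ a → Listed n a × SubFace {m} {n} (c , b) (ineq n a)
  candidate with ∣ T ∣ <? n
  ... | yes ∣T∣<n = subset T , (1≤∣T∣ , inj₁ ∣T∣<n) , λ w on → onFace⁺ n (subset T) (proj₁ on) (tight-T on)
  ... | no  ∣T∣≮n = subset ⊤ , (≤-trans 1≤∣T∣ ∣T∣≤∣⊤∣ , inj₂ (∣⊤∣≡n m)) ,
                     λ w on → onFace⁺ n (subset ⊤) (proj₁ on) (tight-⊤ (≮⇒≥ ∣T∣≮n) on)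

zero-functional-improper : ∀ {c : Fin m → ℚ} {b} → (∀ j → c j ≡ 0ℚ) →
                           NonEmpty {m} {n} (c , b) → ¬ Proper {m} {n} (c , b)
zero-functional-improper {c = c} c≡0 (w₀ , _ , on₀) (w₁ , _ , below₁) =
  ℚₚ.<-irrefl (trans (dot≡0 w₁) (sym (dot≡0 w₀))) (subst (_ ℚ.<_) (sym on₀) below₁)
  where
  dot≡0 : ∀ w → dot c w ≡ 0ℚ
  dot≡0 w = trans (dot≡· c w) (·-zeroˡ (values w) c≡0)

face⊆candidate : ∀ n (f : Ineq (suc m)) → IsFace {suc m} {n} f → Proper {suc m} {n} f →
                 ∃ λ a → Listed n a × SubFace {suc m} {n} f (ineq n a)
face⊆candidate n (c , b) (supp , nonEmpty) proper with any? (λ i → c i ℚ.<? 0ℚ)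
... | yes (i , ci<0) = coordinate i , tt , λ w (valid , on) → onFace⁺ n (coordinate i) valid
  (TightPoint.zero-where-negative {c = c} {b} supp (admissible-values valid) (trans (sym (dot≡· c w)) on) i ci<0)
... | no  no-negative with argmax c
...   | i , c≤ci with 0ℚ ℚ.<? c i
...     | yes 0<ci = MaxSet.candidate n supp 0<ci c≤ci
...     | no  ci≯0 = contradiction proper (zero-functional-improper c≡0 nonEmpty)
  where
  c≡0 : ∀ j → c j ≡ 0ℚ
  c≡0 j = ℚₚ.≤-antisym (ℚₚ.≤-trans (c≤ci j) (ℚₚ.≮⇒≥ ci≯0)) (ℚₚ.≮⇒≥ λ cj<0 → no-negative (j , cj<0))

_≟ᶜ_ : DecidableEquality (Candidate m)
_≟ᶜ_ = ⊎.≡-dec _≟ᶠ_ (Vec.≡-dec Bool._≟_)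

candidate-⊆⇒≡ : ∀ n {a b : Candidate m} → Listed (suc n) a → Listed (suc n) b →
                SubFace {m} {suc n} (ineq (suc n) a) (ineq (suc n) b) → a ≡ b
candidate-⊆⇒≡ n {a} {b} listed-a listed-b a⊆b with a ≟ᶜ b
... | yes a≡b = a≡b
... | no  a≢b with separating-word (suc n) a b (separate n a b listed-a listed-b a≢b)
...   | w , on-a , ¬on-b = contradiction (a⊆b w on-a) ¬on-b

candidate-facet : ∀ n (a : Candidate (suc m)) → Listed (suc n) a → IsFacet {suc m} {suc n} (ineq (suc n) a)
candidate-facet {m} n a listed = candidate-face (suc n) a , candidate-proper n a listed , maximal
  where
  maximal : ∀ g → IsFace {suc m} {suc n} g → Proper {suc m} {suc n} g →
            SubFace {suc m} {suc n} (ineq (suc n) a) g → SubFace {suc m} {suc n} g (ineq (suc n) a)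
  maximal g g-face g-proper a⊆g = within (face⊆candidate (suc n) g g-face g-proper)
    where
    within : (∃ λ h → Listed (suc n) h × SubFace {suc m} {suc n} g (ineq (suc n) h)) →
             SubFace {suc m} {suc n} g (ineq (suc n) a)
    within (h , listed-h , g⊆h) = subst (λ h → SubFace {suc m} {suc n} g (ineq (suc n) h))
      (sym (candidate-⊆⇒≡ n listed listed-h (λ w → g⊆h w ∘ a⊆g w))) g⊆h

listed-distinct : ∀ n {a b : Candidate m} → Listed (suc n) a → Listed (suc n) b → a ≢ b →
                  ¬ SameFace {m} {suc n} (ineq (suc n) a) (ineq (suc n) b)
listed-distinct n listed-a listed-b a≢b same =
  a≢b (candidate-⊆⇒≡ n listed-a listed-b (λ w → Equivalence.to (same w)))

facet-listed : ∀ n (f : Ineq (suc m)) → IsFacet {suc m} {suc n} f →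
               ∃ λ a → Listed (suc n) a × SameFace {suc m} {suc n} f (ineq (suc n) a)
facet-listed {m} n f (f-face , f-proper , f-maximal) = within (face⊆candidate (suc n) f f-face f-proper)
  where
  within : (∃ λ a → Listed (suc n) a × SubFace {suc m} {suc n} f (ineq (suc n) a)) →
           ∃ λ a → Listed (suc n) a × SameFace {suc m} {suc n} f (ineq (suc n) a)
  within (a , listed , f⊆a) =
    a , listed , λ w → mk⇔ (f⊆a w) (a⊆f w)
    where
    a⊆f : SubFace {suc m} {suc n} (ineq (suc n) a) f
    a⊆f = f-maximal (ineq (suc n) a) (candidate-face (suc n) a) (candidate-proper n a listed) f⊆a

-- Counting subsets by size

allSubsets : ∀ m → List (Subset m)
allSubsets zero    = [] ∷ []
allSubsets (suc m) = List.map (outside ∷_) (allSubsets m) ++ List.map (inside ∷_) (allSubsets m)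

∈-allSubsets : ∀ (S : Subset m) → S ∈ˡ allSubsets m
∈-allSubsets []            = here refl
∈-allSubsets (outside ∷ S) = ∈-++⁺ˡ (∈-map⁺ (outside ∷_) (∈-allSubsets S))
∈-allSubsets (inside  ∷ S) =
  ∈-++⁺ʳ (List.map (outside ∷_) (allSubsets _)) (∈-map⁺ (inside ∷_) (∈-allSubsets S))

allSubsets-unique : ∀ m → Unique (allSubsets m)
allSubsets-unique zero    = [] ∷ []
allSubsets-unique (suc m) = Unique.++⁺ (Unique.map⁺ ∷-injectiveʳ (allSubsets-unique m))
                                       (Unique.map⁺ ∷-injectiveʳ (allSubsets-unique m)) disjoint
  where
  disjoint : ∀ {S} → ¬ (S ∈ˡ List.map (outside ∷_) (allSubsets m) ×
                         S ∈ˡ List.map (inside  ∷_) (allSubsets m))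
  disjoint (∈out , ∈in) with ∈-map⁻ (outside ∷_) ∈out | ∈-map⁻ (inside ∷_) ∈in
  ... | _ , _ , refl | _ , _ , ()

length-filter-map : ∀ {a b p} {A : Set a} {B : Set b} {P : Pred B p} (P? : Decidable P) (f : A → B) xs →
                    length (filter P? (List.map f xs)) ≡ length (filter (P? ∘ f) xs)
length-filter-map P? f []       = refl
length-filter-map P? f (x ∷ xs) with does (P? (f x))
... | true  = cong suc (length-filter-map P? f xs)
... | false = length-filter-map P? f xs

countBySize : ∀ {p} {P : Pred ℕ p} → Decidable P → ℕ → ℕ
countBySize P? m = length (filter (P? ∘ ∣_∣) (allSubsets m))

countBySize-suc : ∀ {p} {P : Pred ℕ p} (P? : Decidable P) m →
                  countBySize P? (suc m) ≡ countBySize P? m + countBySize (P? ∘ suc) m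
countBySize-suc P? m = begin
  length (filter (P? ∘ ∣_∣) (List.map (outside ∷_) all ++ List.map (inside ∷_) all))
    ≡⟨ cong length (filter-++ (P? ∘ ∣_∣) (List.map (outside ∷_) all) _) ⟩
  length (filter (P? ∘ ∣_∣) (List.map (outside ∷_) all) ++ filter (P? ∘ ∣_∣) (List.map (inside ∷_) all))
    ≡⟨ length-++ (filter (P? ∘ ∣_∣) (List.map (outside ∷_) all)) ⟩
  length (filter (P? ∘ ∣_∣) (List.map (outside ∷_) all)) + length (filter (P? ∘ ∣_∣) (List.map (inside ∷_) all))
    ≡⟨ cong₂ _+_ (length-filter-map (P? ∘ ∣_∣) (outside ∷_) all)
                 (length-filter-map (P? ∘ ∣_∣) (inside ∷_) all) ⟩
  countBySize P? m + countBySize (P? ∘ suc) m ∎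
  where
  open ≡-Reasoning
  all = allSubsets m

countBySize-none : ∀ {p} {P : Pred ℕ p} (P? : Decidable P) m → (∀ {k} → k ≤ m → ¬ P k) →
                   countBySize P? m ≡ 0
countBySize-none P? m ¬P =
  cong length (filter-none (P? ∘ ∣_∣) (All.universal (λ S → ¬P (∣p∣≤n S)) (allSubsets m)))

countBySize-cong : ∀ {p q} {P : Pred ℕ p} {Q : Pred ℕ q} (P? : Decidable P) (Q? : Decidable Q) m →
                   (∀ {k} → k ≤ m → P k → Q k) → (∀ {k} → k ≤ m → Q k → P k) →
                   countBySize P? m ≡ countBySize Q? m
countBySize-cong P? Q? m P⇒Q Q⇒P = cong length
  (filter-≐ (P? ∘ ∣_∣) (Q? ∘ ∣_∣) ((λ {S} → P⇒Q (∣p∣≤n S)) , (λ {S} → Q⇒P (∣p∣≤n S))) (allSubsets m))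

countBySize-complement : ∀ {p} {P : Pred ℕ p} (P? : Decidable P) m →
                         countBySize P? m + countBySize (¬? ∘ P?) m ≡ 2 ^ m
countBySize-complement P? zero with does (P? 0)
... | true  = refl
... | false = refl
countBySize-complement P? (suc m) = begin
  countBySize P? (suc m) + countBySize (¬? ∘ P?) (suc m)
    ≡⟨ cong₂ _+_ (countBySize-suc P? m) (countBySize-suc (¬? ∘ P?) m) ⟩
  (countBySize P? m + countBySize (P? ∘ suc) m) + (countBySize (¬? ∘ P?) m + countBySize (¬? ∘ P? ∘ suc) m)
    ≡⟨ interchange (countBySize P? m) (countBySize (P? ∘ suc) m)
                   (countBySize (¬? ∘ P?) m) (countBySize (¬? ∘ P? ∘ suc) m) ⟩
  (countBySize P? m + countBySize (¬? ∘ P?) m) + (countBySize (P? ∘ suc) m + countBySize (¬? ∘ P? ∘ suc) m)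
    ≡⟨ cong₂ _+_ (countBySize-complement P? m) (countBySize-complement (P? ∘ suc) m) ⟩
  2 ^ m + 2 ^ m
    ≡⟨ cong (2 ^ m +_) (+-identityʳ (2 ^ m)) ⟨
  2 ^ suc m ∎
  where open ≡-Reasoning

countBySize-⊎ : ∀ {p q} {P : Pred ℕ p} {Q : Pred ℕ q} (P? : Decidable P) (Q? : Decidable Q) m →
                (∀ {k} → P k → ¬ Q k) →
                countBySize (λ k → P? k ⊎-dec Q? k) m ≡ countBySize P? m + countBySize Q? m
countBySize-⊎ P? Q? zero P⇒¬Q with P? 0 | Q? 0
... | yes P0 | yes Q0 = contradiction Q0 (P⇒¬Q P0)
... | yes _  | no  _  = refl
... | no  _  | yes _  = refl
... | no  _  | no  _  = refl
countBySize-⊎ P? Q? (suc m) P⇒¬Q = begin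
  countBySize (λ k → P? k ⊎-dec Q? k) (suc m)
    ≡⟨ countBySize-suc (λ k → P? k ⊎-dec Q? k) m ⟩
  countBySize (λ k → P? k ⊎-dec Q? k) m + countBySize (λ k → P? (suc k) ⊎-dec Q? (suc k)) m
    ≡⟨ cong₂ _+_ (countBySize-⊎ P? Q? m P⇒¬Q) (countBySize-⊎ (P? ∘ suc) (Q? ∘ suc) m P⇒¬Q) ⟩
  (countBySize P? m + countBySize Q? m) + (countBySize (P? ∘ suc) m + countBySize (Q? ∘ suc) m)
    ≡⟨ interchange (countBySize P? m) (countBySize Q? m)
                   (countBySize (P? ∘ suc) m) (countBySize (Q? ∘ suc) m) ⟩
  (countBySize P? m + countBySize (P? ∘ suc) m) + (countBySize Q? m + countBySize (Q? ∘ suc) m)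
    ≡⟨ cong₂ _+_ (countBySize-suc P? m) (countBySize-suc Q? m) ⟨
  countBySize P? (suc m) + countBySize Q? (suc m) ∎
  where open ≡-Reasoning

countBySize-≡ : ∀ m k → countBySize (_≟ k) m ≡ m C k
countBySize-≡ zero    zero    = refl
countBySize-≡ zero    (suc k) = refl
countBySize-≡ (suc m) zero    = begin
  countBySize (_≟ 0) (suc m)                             ≡⟨ countBySize-suc (_≟ 0) m ⟩
  countBySize (_≟ 0) m + countBySize (λ j → suc j ≟ 0) m
    ≡⟨ cong₂ _+_ (countBySize-≡ m 0) (countBySize-none (λ j → suc j ≟ 0) m λ _ ()) ⟩
  1 + 0                                                  ∎
  where open ≡-Reasoning
countBySize-≡ (suc m) (suc k) = begin
  countBySize (_≟ suc k) (suc m)                                ≡⟨ countBySize-suc (_≟ suc k) m ⟩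
  countBySize (_≟ suc k) m + countBySize (λ j → suc j ≟ suc k) m  ≡⟨ cong (countBySize (_≟ suc k) m +_) shift ⟩
  countBySize (_≟ suc k) m + countBySize (_≟ k) m               ≡⟨ cong₂ _+_ (countBySize-≡ m (suc k)) (countBySize-≡ m k) ⟩
  m C suc k + m C k                                             ≡⟨ +-comm (m C suc k) (m C k) ⟩
  m C k + m C suc k                                             ≡⟨ nCk+nC[k+1]≡[n+1]C[k+1] m k ⟩
  suc m C suc k                                                 ∎
  where
  open ≡-Reasoning
  shift : countBySize (λ j → suc j ≟ suc k) m ≡ countBySize (_≟ k) m
  shift = countBySize-cong (λ j → suc j ≟ suc k) (_≟ k) m (λ _ → suc-injective) (λ _ → cong suc)

InRange : ℕ → ℕ → ℕ → Set
InRange l u k = l ≤ k × k < u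

inRange? : ∀ l u → Decidable (InRange l u)
inRange? l u k = (l ≤? k) ×-dec (k <? u)

countBySize-top : ∀ m r → r ≤ m → countBySize (inRange? (m ∸ r) m) m ≡ binomSum m r
countBySize-top m zero    _   = countBySize-none (inRange? m m) m λ _ (m≤k , k<m) → <⇒≱ k<m m≤k
countBySize-top m (suc r) r<m = begin
  countBySize (inRange? a m) m
    ≡⟨ countBySize-cong (inRange? a m) (λ k → inRange? (m ∸ r) m k ⊎-dec (k ≟ a)) m split merge ⟩
  countBySize (λ k → inRange? (m ∸ r) m k ⊎-dec (k ≟ a)) m
    ≡⟨ countBySize-⊎ (inRange? (m ∸ r) m) (_≟ a) m disjoint ⟩
  countBySize (inRange? (m ∸ r) m) m + countBySize (_≟ a) m
    ≡⟨ cong₂ _+_ (countBySize-top m r (<⇒≤ r<m)) (countBySize-≡ m a) ⟩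
  binomSum m r + m C a ∎
  where
  open ≡-Reasoning
  a = m ∸ suc r
  m∸r≡1+a : m ∸ r ≡ suc a
  m∸r≡1+a = +-∸-assoc 1 r<m
  split : ∀ {k} → k ≤ m → InRange a m k → InRange (m ∸ r) m k ⊎ k ≡ a
  split {k} _ (a≤k , k<m) with k ≟ a
  ... | yes k≡a = inj₂ k≡a
  ... | no  k≢a = inj₁ (subst (_≤ k) (sym m∸r≡1+a) (≤∧≢⇒< a≤k (k≢a ∘ sym)) , k<m)
  merge : ∀ {k} → k ≤ m → InRange (m ∸ r) m k ⊎ k ≡ a → InRange a m k
  merge _ (inj₁ (m∸r≤k , k<m)) = ≤-trans (∸-monoʳ-≤ m (n≤1+n r)) m∸r≤k , k<m
  merge _ (inj₂ refl)          = ≤-refl , ∸-monoʳ-< z<s r<m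
  disjoint : ∀ {k} → InRange (m ∸ r) m k → k ≢ a
  disjoint (m∸r≤k , _) refl = n≮n a (subst (_≤ a) m∸r≡1+a m∸r≤k)

countBySize-inRange : ∀ m l → countBySize (inRange? l m) m ≡ binomSum m (m ∸ l)
countBySize-inRange m l with l ≤? m
... | yes l≤m = trans (countBySize-cong (inRange? l m) (inRange? (m ∸ (m ∸ l)) m) m
                         (λ _ → map₁ (subst (_≤ _) (sym lower≡l))) (λ _ → map₁ (subst (_≤ _) lower≡l)))
                      (countBySize-top m (m ∸ l) (m∸n≤m m l))
  where
  lower≡l : m ∸ (m ∸ l) ≡ l
  lower≡l = m∸[m∸n]≡n l≤m
... | no  l≰m rewrite m≤n⇒m∸n≡0 (<⇒≤ (≰⇒> l≰m)) =
  countBySize-none (inRange? l m) m λ _ (l≤k , k<m) → l≰m (≤-trans l≤k (<⇒≤ k<m))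

countBySize-listed : ∀ m n → 1 ≤ n → countBySize (listedSize? m n) m + binomSum m (m ∸ n) + 1 ≡ 2 ^ m
countBySize-listed m n 1≤n = begin
  listed + binomSum m (m ∸ n) + 1                ≡⟨ +-assoc listed _ 1 ⟩
  listed + (binomSum m (m ∸ n) + 1)              ≡⟨ cong (listed +_) (+-comm (binomSum m (m ∸ n)) 1) ⟩
  listed + (m C 0 + binomSum m (m ∸ n))          ≡⟨ cong (listed +_) unlisted ⟨
  listed + countBySize (¬? ∘ listedSize? m n) m  ≡⟨ countBySize-complement (listedSize? m n) m ⟩
  2 ^ m                                          ∎
  where
  open ≡-Reasoning
  listed = countBySize (listedSize? m n) m
  to : ∀ {k} → k ≤ m → ¬ ListedSize m n k → k ≡ 0 ⊎ InRange n m k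
  to {zero}  _   _        = inj₁ refl
  to {suc k} k≤m unlisted =
    inj₂ (≮⇒≥ (λ k<n → unlisted (s≤s z≤n , inj₁ k<n)) , ≤∧≢⇒< k≤m (λ k≡m → unlisted (s≤s z≤n , inj₂ k≡m)))
  from : ∀ {k} → k ≤ m → k ≡ 0 ⊎ InRange n m k → ¬ ListedSize m n k
  from _ (inj₁ refl)          (() , _)
  from _ (inj₂ (n≤k , k<m)) (_ , inj₁ k<n) = <⇒≱ k<n n≤k
  from _ (inj₂ (n≤k , k<m)) (_ , inj₂ k≡m) = <-irrefl k≡m k<m
  unlisted : countBySize (¬? ∘ listedSize? m n) m ≡ m C 0 + binomSum m (m ∸ n)
  unlisted = begin
    countBySize (¬? ∘ listedSize? m n) m
      ≡⟨ countBySize-cong (¬? ∘ listedSize? m n) (λ k → (k ≟ 0) ⊎-dec inRange? n m k) m to from ⟩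
    countBySize (λ k → (k ≟ 0) ⊎-dec inRange? n m k) m
      ≡⟨ countBySize-⊎ (_≟ 0) (inRange? n m) m (λ { refl (n≤0 , _) → <⇒≱ 1≤n n≤0 }) ⟩
    countBySize (_≟ 0) m + countBySize (inRange? n m) m
      ≡⟨ cong₂ _+_ (countBySize-≡ m 0) (countBySize-inRange m n) ⟩
    m C 0 + binomSum m (m ∸ n) ∎

candidates : ℕ → ∀ m → List (Candidate m)
candidates n m = List.map coordinate (allFin m) ++ List.map subset (filter (listedSize? m n ∘ ∣_∣) (allSubsets m))

candidates-listed : ∀ n m → All (Listed n) (candidates n m)
candidates-listed n m = All.++⁺ (All.map⁺ (All.universal (λ _ → tt) (allFin m)))
                                (All.map⁺ (All.all-filter (listedSize? m n ∘ ∣_∣) (allSubsets m)))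

candidates-unique : ∀ n m → Unique (candidates n m)
candidates-unique n m = Unique.++⁺ (Unique.map⁺ ⊎.inj₁-injective (Unique.allFin⁺ m))
  (Unique.map⁺ ⊎.inj₂-injective (Unique.filter⁺ (listedSize? m n ∘ ∣_∣) (allSubsets-unique m))) disjoint
  where
  disjoint : ∀ {a} → ¬ (a ∈ˡ List.map coordinate (allFin m) ×
                         a ∈ˡ List.map subset (filter (listedSize? m n ∘ ∣_∣) (allSubsets m)))
  disjoint (∈coordinates , ∈subsets) with ∈-map⁻ coordinate ∈coordinates | ∈-map⁻ subset ∈subsets
  ... | _ , _ , refl | _ , _ , ()

∈-candidates : ∀ n {a : Candidate m} → Listed n a → a ∈ˡ candidates n m
∈-candidates n {coordinate i} _      = ∈-++⁺ˡ (∈-map⁺ coordinate (∈-allFin i))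
∈-candidates n {subset S}     listed =
  ∈-++⁺ʳ (List.map coordinate (allFin _))
         (∈-map⁺ subset (∈-filter⁺ (listedSize? _ n ∘ ∣_∣) (∈-allSubsets S) listed))

candidates-count : ∀ m n → 1 ≤ n → length (candidates n m) + binomSum m (m ∸ n) + 1 ≡ m + 2 ^ m
candidates-count m n 1≤n = begin
  length (coordinates ++ subsets) + binomSum m (m ∸ n) + 1
    ≡⟨ cong (λ l → l + binomSum m (m ∸ n) + 1) (length-++ coordinates) ⟩
  length coordinates + length subsets + binomSum m (m ∸ n) + 1
    ≡⟨ cong₂ (λ k l → k + l + binomSum m (m ∸ n) + 1)
             (trans (length-map coordinate (allFin m)) (length-tabulate {n = m} id)) (length-map subset listed) ⟩
  m + countBySize (listedSize? m n) m + binomSum m (m ∸ n) + 1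
    ≡⟨ cong (_+ 1) (+-assoc m _ _) ⟩
  m + (countBySize (listedSize? m n) m + binomSum m (m ∸ n)) + 1
    ≡⟨ +-assoc m _ 1 ⟩
  m + (countBySize (listedSize? m n) m + binomSum m (m ∸ n) + 1)
    ≡⟨ cong (m +_) (countBySize-listed m n 1≤n) ⟩
  m + 2 ^ m ∎
  where
  open ≡-Reasoning
  listed = filter (listedSize? m n ∘ ∣_∣) (allSubsets m)
  coordinates subsets : List (Candidate m)
  coordinates = List.map coordinate (allFin m)
  subsets     = List.map subset listed

allPairs-restrict : ∀ {a p r s} {A : Set a} {P : A → Set p} {R : A → A → Set r} {S : A → A → Set s} →
                    (∀ {x y} → P x → P y → R x y → S x y) → ∀ {xs} → All P xs → AllPairs R xs → AllPairs S xs
allPairs-restrict f []         []         = []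
allPairs-restrict f (px ∷ pxs) (rx ∷ rxs) =
  All.zipWith (λ (py , r) → f px py r) (pxs , rx) ∷ allPairs-restrict f pxs rxs

theorem5p10 : (m n : ℕ) → 1 ≤ m → 1 ≤ n →
    Σ (List (Ineq m)) λ L →
      All (IsFacet {m} {n}) L
      × AllPairs (λ f g → ¬ SameFace {m} {n} f g) L
      × ((f : Ineq m) → IsFacet {m} {n} f → Any (SameFace {m} {n} f) L)
      × length L + binomSum m (m ∸ n) + 1 ≡ m + 2 ^ m
theorem5p10 (suc m) (suc n) _ _ =
  List.map (ineq (suc n)) listed ,
  All.map⁺ (All.map (candidate-facet n _) all-listed) ,
  AllPairs.map⁺ (allPairs-restrict (listed-distinct n) all-listed (candidates-unique (suc n) (suc m))) ,
  (λ f f-facet → let a , listed-a , same = facet-listed n f f-facet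
                 in Any.map⁺ (lose (∈-candidates (suc n) listed-a) same)) ,
  trans (cong (λ l → l + binomSum (suc m) (m ∸ n) + 1) (length-map (ineq (suc n)) listed))
        (candidates-count (suc m) (suc n) (s≤s z≤n))
  where
  listed = candidates (suc n) (suc m)
  all-listed = candidates-listed (suc n) (suc m)
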